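{- Let $\mathbf f\in\{ -1,1\}^n$ be a finite sequence of unfolding instructions of length $n\ge 1$. Then the run-length sequence $R_{\mathbf f}$, the sequence $S_{\mathbf f}$ of starting positions of runs and the sequence $E_{\mathbf f}$ of ending positions of runs of the finite paperfolding sequence $P_{\mathbf f}$ each have length $2^{n-1}$ (i.e. $P_{\mathbf f}$ has exactly $2^{n-1}$ runs).
   Context: For a finite sequence $\mathbf f$ over $\{ -1,1\}$ define $P_\epsilon=\epsilon$ (the empty sequence) and $P_{\mathbf f a}=P_{\mathbf f}\ a\ (-P_{\mathbf f}^R)$ for $a\in\{ -1,1\}$, where $-x$ negates every entry of $x$ and $x^R$ is the reversal of $x$; thus $|P_{\mathbf f}|=2^{|\mathbf f|}-1$. Write $P_{\mathbf f}=p_1p_2\cdots$ (indexed from $1$). A run is a maximal block of consecutive identical entries. Enumerating the runs of $P_{\mathbf f}$ from left to right starting at $1$, $R_{\mathbf f}[n]$ is the length of the $n$-th run, and $S_{\mathbf f}[n]$, $E_{\mathbf f}[n]$ are the positions of its first and last entries. -}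

module Defs where

open import Data.Bool using (Bool; true; false; if_then_else_)
open import Data.Nat using (ℕ; zero; suc; _+_; _∸_)
open import Data.List using (List; []; _∷_; _++_; reverse; map; foldl; [_])
open import Data.Product using (_×_; _,_; proj₁; proj₂)

data Sign : Set where
  -1ₛ +1ₛ : Sign

negₛ : Sign → Sign
negₛ -1ₛ = +1ₛ
negₛ +1ₛ = -1ₛ

eqₛ : Sign → Sign → Bool
eqₛ -1ₛ -1ₛ = true
eqₛ +1ₛ +1ₛ = true
eqₛ _   _   = false

unfold : List Sign → Sign → List Sign
unfold P a = P ++ (a ∷ map negₛ (reverse P))

P : List Sign → List Sign
P f = foldl unfold [] f

-- A run is recorded as (start position, end position), positions indexed from 1.
-- runsFrom i x xs : the runs of the sequence x ∷ xs, whose first entry is at position i,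
-- listed from left to right.
runsFrom : ℕ → Sign → List Sign → List (ℕ × ℕ)
runsFrom i x [] = (i , i) ∷ []
runsFrom i x (y ∷ ys) with eqₛ x y | runsFrom (suc i) y ys
... | true  | [] = (i , i) ∷ []   -- impossible case
... | true  | ((s , e) ∷ rs) = (i , e) ∷ rs
... | false | rs = (i , i) ∷ rs

runs : List Sign → List (ℕ × ℕ)
runs [] = []
runs (x ∷ xs) = runsFrom 1 x xs

-- S_f, E_f, R_f as lists (S_f[n] is the n-th element, counting from 1)
S : List Sign → List ℕ
S f = map proj₁ (runs (P f))

E : List Sign → List ℕ
E f = map proj₂ (runs (P f))

R : List Sign → List ℕ
R f = map (λ r → suc (proj₂ r ∸ proj₁ r)) (runs (P f))

-- P_f has one more run than it has changes (adjacent entries that differ), and unfolding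
-- doubles the number of runs: the changes of Q a (−Q^R) are those of Q, those of −Q^R
-- (as many, since negation and reversal preserve changes), plus the two around a, of
-- which exactly one is a change because a equals exactly one of last Q and −last Q.
-- Starting from the single run of P_{f₁}, the n − 1 further unfoldings give 2^{n−1} runs.
module Submission where

open import Defs
open import Data.Bool using (true; false; if_then_else_)
open import Data.Nat using (ℕ; suc; _+_; _*_; _^_)
open import Data.Nat.Properties using (+-assoc; +-comm; +-identityʳ; +-suc; *-assoc; *-comm; *-identityʳ)
open import Data.List using (List; []; _∷_; _++_; [_]; _∷ʳ_; reverse; map; foldl; length; initLast; _∷ʳ′_)
open import Data.List.Properties using (length-map; ++-assoc; reverse-++; ʳ++-defn; unfold-reverse)
open import Data.Product using (_×_; _,_)
open import Function using (_∘_)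
open import Relation.Nullary using (contradiction)
open import Relation.Binary.PropositionalEquality using (_≡_; _≢_; refl; sym; trans; cong; cong₂; module ≡-Reasoning)

differ : Sign → Sign → ℕ
differ x y = if eqₛ x y then 0 else 1

differ-sym : ∀ x y → differ x y ≡ differ y x
differ-sym -1ₛ -1ₛ = refl
differ-sym -1ₛ +1ₛ = refl
differ-sym +1ₛ -1ₛ = refl
differ-sym +1ₛ +1ₛ = refl

differ-negₛ : ∀ x y → differ (negₛ x) (negₛ y) ≡ differ x y
differ-negₛ -1ₛ -1ₛ = refl
differ-negₛ -1ₛ +1ₛ = refl
differ-negₛ +1ₛ -1ₛ = refl
differ-negₛ +1ₛ +1ₛ = refl

differ+differ-negₛ≡1 : ∀ x a → differ x a + differ a (negₛ x) ≡ 1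
differ+differ-negₛ≡1 -1ₛ -1ₛ = refl
differ+differ-negₛ≡1 -1ₛ +1ₛ = refl
differ+differ-negₛ≡1 +1ₛ -1ₛ = refl
differ+differ-negₛ≡1 +1ₛ +1ₛ = refl

changes : List Sign → ℕ
changes (x ∷ y ∷ ys) = differ x y + changes (y ∷ ys)
changes _            = 0

runCount : List Sign → ℕ
runCount []       = 0
runCount (x ∷ xs) = suc (changes (x ∷ xs))

runCount-nonempty : ∀ {l} → l ≢ [] → runCount l ≡ suc (changes l)
runCount-nonempty {[]}    l≢[] = contradiction refl l≢[]
runCount-nonempty {_ ∷ _} _    = refl

length-runsFrom : ∀ i x xs → length (runsFrom i x xs) ≡ runCount (x ∷ xs)
length-runsFrom i x []       = refl
length-runsFrom i x (y ∷ ys) with eqₛ x y | runsFrom (suc i) y ys | length-runsFrom (suc i) y ys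
... | true  | []     | ()
... | true  | _ ∷ _  | eq = eq
... | false | _      | eq = cong suc eq

length-runs : ∀ l → length (runs l) ≡ runCount l
length-runs []       = refl
length-runs (x ∷ xs) = length-runsFrom 1 x xs

changes-++-∷ : ∀ xs y ys → changes (xs ++ y ∷ ys) ≡ changes (xs ∷ʳ y) + changes (y ∷ ys)
changes-++-∷ []           y ys = refl
changes-++-∷ (x ∷ [])     y ys = cong (_+ changes (y ∷ ys)) (sym (+-identityʳ (differ x y)))
changes-++-∷ (x ∷ x′ ∷ xs) y ys =
  trans (cong (differ x x′ +_) (changes-++-∷ (x′ ∷ xs) y ys))
        (sym (+-assoc (differ x x′) _ _))

changes-map-negₛ : ∀ l → changes (map negₛ l) ≡ changes l
changes-map-negₛ []           = refl
changes-map-negₛ (x ∷ [])     = refl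
changes-map-negₛ (x ∷ y ∷ ys) = cong₂ _+_ (differ-negₛ x y) (changes-map-negₛ (y ∷ ys))

changes-reverse : ∀ l → changes (reverse l) ≡ changes l
changes-reverse []           = refl
changes-reverse (x ∷ [])     = refl
changes-reverse (x ∷ y ∷ ys) = begin
  changes (reverse (x ∷ y ∷ ys))           ≡⟨ cong changes (ʳ++-defn ys) ⟩
  changes (reverse ys ++ y ∷ [ x ])        ≡⟨ changes-++-∷ (reverse ys) y [ x ] ⟩
  changes (reverse ys ∷ʳ y) + (differ y x + 0)
    ≡⟨ cong (_+ (differ y x + 0)) (cong changes (sym (unfold-reverse y ys))) ⟩
  changes (reverse (y ∷ ys)) + (differ y x + 0)
    ≡⟨ cong₂ _+_ (changes-reverse (y ∷ ys)) (trans (+-identityʳ _) (differ-sym y x)) ⟩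
  changes (y ∷ ys) + differ x y            ≡⟨ +-comm _ (differ x y) ⟩
  changes (x ∷ y ∷ ys)                     ∎
  where open ≡-Reasoning

changes-unfold : ∀ Q a → Q ≢ [] → changes (unfold Q a) ≡ suc (changes Q + changes Q)
changes-unfold Q a Q≢[] with initLast Q
... | []       = contradiction refl Q≢[]
... | Q′ ∷ʳ′ l = begin
  changes ((Q′ ∷ʳ l) ++ a ∷ map negₛ (reverse (Q′ ∷ʳ l)))
    ≡⟨ cong (λ r → changes ((Q′ ∷ʳ l) ++ a ∷ map negₛ r)) (reverse-++ Q′ [ l ]) ⟩
  changes ((Q′ ∷ʳ l) ++ a ∷ negₛ l ∷ N)
    ≡⟨ cong changes (++-assoc Q′ [ l ] _) ⟩
  changes (Q′ ++ l ∷ a ∷ negₛ l ∷ N)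
    ≡⟨ changes-++-∷ Q′ l _ ⟩
  c + (differ l a + (differ a (negₛ l) + changes (negₛ l ∷ N)))
    ≡⟨ cong (λ d → c + (differ l a + (differ a (negₛ l) + d))) mirror ⟩
  c + (differ l a + (differ a (negₛ l) + c))
    ≡⟨ cong (c +_) (sym (+-assoc (differ l a) _ c)) ⟩
  c + (differ l a + differ a (negₛ l) + c)
    ≡⟨ cong (λ d → c + (d + c)) (differ+differ-negₛ≡1 l a) ⟩
  c + suc c
    ≡⟨ +-suc c c ⟩
  suc (c + c) ∎
  where
  open ≡-Reasoning
  c = changes (Q′ ∷ʳ l)
  N = map negₛ (reverse Q′)
  mirror : changes (negₛ l ∷ N) ≡ c
  mirror = begin
    changes (negₛ l ∷ N)                   ≡⟨ cong (changes ∘ map negₛ) (sym (reverse-++ Q′ [ l ])) ⟩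
    changes (map negₛ (reverse (Q′ ∷ʳ l))) ≡⟨ changes-map-negₛ (reverse (Q′ ∷ʳ l)) ⟩
    changes (reverse (Q′ ∷ʳ l))            ≡⟨ changes-reverse (Q′ ∷ʳ l) ⟩
    c                                       ∎

unfold-nonempty : ∀ Q a → unfold Q a ≢ []
unfold-nonempty []      a ()
unfold-nonempty (_ ∷ _) a ()

runCount-unfold : ∀ Q a → Q ≢ [] → runCount (unfold Q a) ≡ 2 * runCount Q
runCount-unfold Q a Q≢[] = begin
  runCount (unfold Q a)             ≡⟨ runCount-nonempty (unfold-nonempty Q a) ⟩
  suc (changes (unfold Q a))        ≡⟨ cong suc (changes-unfold Q a Q≢[]) ⟩
  suc (suc (changes Q + changes Q)) ≡⟨ cong suc (sym (+-suc (changes Q) (changes Q))) ⟩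
  suc (changes Q) + suc (changes Q) ≡⟨ cong (suc (changes Q) +_) (sym (+-identityʳ _)) ⟩
  2 * suc (changes Q)               ≡⟨ cong (2 *_) (sym (runCount-nonempty Q≢[])) ⟩
  2 * runCount Q                    ∎
  where open ≡-Reasoning

runCount-foldl-unfold : ∀ f Q → Q ≢ [] → runCount (foldl unfold Q f) ≡ 2 ^ length f * runCount Q
runCount-foldl-unfold []      Q Q≢[] = sym (+-identityʳ (runCount Q))
runCount-foldl-unfold (a ∷ f) Q Q≢[] = begin
  runCount (foldl unfold (unfold Q a) f)  ≡⟨ runCount-foldl-unfold f (unfold Q a) (unfold-nonempty Q a) ⟩
  2 ^ length f * runCount (unfold Q a)    ≡⟨ cong (2 ^ length f *_) (runCount-unfold Q a Q≢[]) ⟩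
  2 ^ length f * (2 * runCount Q)         ≡⟨ sym (*-assoc (2 ^ length f) 2 _) ⟩
  2 ^ length f * 2 * runCount Q           ≡⟨ cong (_* runCount Q) (*-comm (2 ^ length f) 2) ⟩
  2 ^ suc (length f) * runCount Q         ∎
  where open ≡-Reasoning

runCount-P : ∀ a f → runCount (P (a ∷ f)) ≡ 2 ^ length f
runCount-P a f = trans (runCount-foldl-unfold f [ a ] (λ ())) (*-identityʳ (2 ^ length f))

proposition1 : (n : ℕ) → (f : List Sign) → length f ≡ suc n →
    (length (R f) ≡ 2 ^ n) × (length (S f) ≡ 2 ^ n) × (length (E f) ≡ 2 ^ n)
proposition1 n (a ∷ f) refl = runsOf _ , runsOf _ , runsOf _
  where
  runsOf : ∀ {B : Set} (g : ℕ × ℕ → B) → length (map g (runs (P (a ∷ f)))) ≡ 2 ^ length f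
  runsOf g = trans (length-map g (runs (P (a ∷ f))))
                   (trans (length-runs (P (a ∷ f))) (runCount-P a f))
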